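{- For every partition $\lambda$, the Sprague–Grundy value of $\lambda$ in \textsc{RIT} equals the Sprague–Grundy value of $\mathrm{rem}(\lambda)$ in \textsc{Nim}: $\mathcal{G}_{\textsc{RIT}}(\lambda)=\mathcal{G}_{\textsc{Nim}}(\mathrm{rem}(\lambda))$.
   Context: An \textsc{RIT} (Row Impartial Terminus) position is a partition $\lambda=(\lambda_1,\dots,\lambda_r)$, written as a nonincreasing tuple of nonnegative integers (a move keeps the length $r$ of the tuple, zero entries being allowed; the empty partition is the unique terminal position). For $k\in[1,\lambda_1]$, there is a move from $\lambda$ to $\bar\lambda$ where $\bar\lambda_i=k-1$ for $i$ the largest index with $\lambda_i\ge k$, and $\bar\lambda_j=\lambda_j$ for $j\ne i$. Informally, a move shortens one row of the Young diagram so that the result is still a Young diagram. Define $\mathrm{rem}(\lambda)$ to be the $\lceil r/2\rceil$-tuple $(\lambda_1-\lambda_2,\lambda_3-\lambda_4,\dots,\lambda_{2\lceil r/2\rceil-1}-\lambda_{2\lceil r/2\rceil})$, where $\lambda_j=0$ for $j>r$ (so $\mathrm{rem}$ of the empty partition is the empty tuple). \textsc{Nim} is played on tuples of nonnegative integers: a move decreases exactly one coordinate by a positive amount. The Sprague–Grundy value of a position $x$ of an impartial game is $\mathcal{G}(x)=\mathrm{mex}\{\mathcal{G}(y): x\to y\}$, where $\mathrm{mex}(S)$ is the least nonnegative integer not in $S$ (so terminal positions have value $0$). -}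

module Defs where

open import Data.Nat using (ℕ; zero; suc; _<_; _≤_; _∸_; _≥_; _≤?_)
open import Data.List using (List; []; _∷_)
open import Data.Bool.ListAction using (any)
open import Data.List.Relation.Unary.Linked using (Linked)
open import Data.Product using (Σ; ∃; _×_)
open import Data.Bool using (if_then_else_)
open import Relation.Binary.PropositionalEquality using (_≡_; _≢_)
open import Relation.Nullary.Decidable using (⌊_⌋)

-- IsSG _⇒_ x g  means  "G(x) = g", i.e. g = mex { G(y) : x ⇒ y }:
--  * every h < g is the value of some option, and
--  * no option has value g.
-- (For well-founded games this relation is functional and total, and it
--  is exactly the recursive mex definition.)

data IsSG {A : Set} (_⇒_ : A → A → Set) : A → ℕ → Set where
  isSG : ∀ {x g} →
         (∀ {h} → h < g → ∃ λ y → (x ⇒ y) × IsSG _⇒_ y h) →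
         (∀ {y} → x ⇒ y → ∃ λ h → IsSG _⇒_ y h × h ≢ g) →
         IsSG _⇒_ x g

-- Partitions: nonincreasing lists of naturals (zeros allowed; the length
-- r is kept by moves).

IsPartition : List ℕ → Set
IsPartition = Linked _≥_

head0 : List ℕ → ℕ
head0 []      = 0
head0 (x ∷ _) = x

-- shorten k λ : set λ_i := k - 1 for the LARGEST index i with λ_i ≥ k
-- (left unchanged if there is no such index).
shorten : ℕ → List ℕ → List ℕ
shorten k []       = []
shorten k (x ∷ xs) =
  if any (λ y → ⌊ k ≤? y ⌋) xs
  then x ∷ shorten k xs
  else (if ⌊ k ≤? x ⌋ then (k ∸ 1) ∷ xs else x ∷ xs)

RITMove : List ℕ → List ℕ → Set
RITMove l m = Σ ℕ λ k → (1 ≤ k) × (k ≤ head0 l) × (m ≡ shorten k l)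

data NimMove : List ℕ → List ℕ → Set where
  here  : ∀ {x y xs} → y < x → NimMove (x ∷ xs) (y ∷ xs)
  there : ∀ {x xs ys} → NimMove xs ys → NimMove (x ∷ xs) (x ∷ ys)

rem : List ℕ → List ℕ
rem []           = []
rem (x ∷ [])     = x ∷ []
rem (x ∷ y ∷ xs) = (x ∸ y) ∷ rem xs

-- An RIT move shortens one row of λ. Under rem, shortening an odd row λ₂ⱼ₋₁ lowers the
-- j-th Nim heap, while shortening an even row λ₂ⱼ raises it; conversely lowering the heap
-- λ₂ⱼ₋₁ ∸ λ₂ⱼ to y is the RIT move shortening row 2j-1 to λ₂ⱼ + y. Hence every Nim option of
-- rem λ comes from an RIT option of λ, and every RIT option of λ is sent to an option of
-- rem λ or to a position having rem λ as an option; either way its Nim value differs from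
-- that of rem λ. Induction on the sum of λ then shows that G(λ) satisfies the mex equations
-- of G(rem λ).
module Submission where

open import Defs
open import Data.Nat using (ℕ; zero; suc; _+_; _∸_; _≤_; _<_; _≤?_; _≟_; z≤n; s≤s)
open import Data.Nat.Properties
open import Data.Nat.Induction using (<-wellFounded)
open import Data.Nat.ListAction using (sum)
open import Data.List using (List; []; _∷_; map; _++_; downFrom)
open import Data.List.Extrema.Nat using (xs≤max)
open import Data.List.Relation.Unary.All as All using (All; []; _∷_)
open import Data.List.Relation.Unary.Any using (here; there)
open import Data.List.Relation.Unary.Linked using ([-]; _∷_; tail)
open import Data.List.Membership.Propositional using (_∈_)
open import Data.List.Membership.Propositional.Properties
  using (∈-map⁺; ∈-map⁻; ∈-++⁺ˡ; ∈-++⁺ʳ; ∈-++⁻; ∈-downFrom⁺; ∈-downFrom⁻)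
open import Data.List.Membership.DecPropositional _≟_ using (_∈?_)
open import Data.Bool using (false)
open import Data.Bool.ListAction using (any)
open import Data.Product using (Σ; ∃; _×_; _,_; proj₁)
open import Data.Sum as Sum using (_⊎_; inj₁; inj₂; [_,_]′)
open import Data.Empty using (⊥-elim)
open import Function using (flip; _∘_)
open import Function.Bundles using (_⇔_; mk⇔; Equivalence)
open import Induction.WellFounded using (Acc; acc; WellFounded; module Subrelation)
import Relation.Binary.Construct.On as On
open import Relation.Binary.PropositionalEquality using (_≡_; _≢_; refl; sym; trans; cong; subst)
open import Relation.Nullary using (¬_; yes; no)
open import Relation.Nullary.Decidable using (⌊_⌋)
open import Relation.Unary using (Decidable)

LeastCounterexample : (ℕ → Set) → ℕ → Set
LeastCounterexample P g = (∀ {h} → h < g → P h) × ¬ P g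

module _ {P : ℕ → Set} (P? : Decidable P) where

  all-below-or-least-counterexample : ∀ n → (∀ {h} → h < n → P h) ⊎ ∃ (LeastCounterexample P)
  all-below-or-least-counterexample zero = inj₁ λ ()
  all-below-or-least-counterexample (suc n) with all-below-or-least-counterexample n | P? n
  ... | inj₂ least | _      = inj₂ least
  ... | inj₁ below | no ¬Pn = inj₂ (n , below , ¬Pn)
  ... | inj₁ below | yes Pn = inj₁ λ h<1+n → [ below , (λ { refl → Pn }) ]′ (m<1+n⇒m<n∨m≡n h<1+n)

  least-counterexample : ∀ {n} → ¬ P n → ∃ (LeastCounterexample P)
  least-counterexample {n} ¬Pn with all-below-or-least-counterexample (suc n)
  ... | inj₁ below = ⊥-elim (¬Pn (below ≤-refl))
  ... | inj₂ least = least

mex : (vs : List ℕ) → ∃ (LeastCounterexample (_∈ vs))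
mex vs = least-counterexample (_∈? vs) λ 1+max∈vs → 1+n≰n (All.lookup (xs≤max 0 vs) 1+max∈vs)

module _ {A : Set} {R : A → ℕ → Set} where

  ∈-reduce-proj₁⁻ : ∀ {ys h} (ps : All (λ y → ∃ (R y)) ys) →
    h ∈ All.reduce proj₁ ps → ∃ λ y → y ∈ ys × R y h
  ∈-reduce-proj₁⁻ ((_ , r) ∷ _)  (here refl) = _ , here refl , r
  ∈-reduce-proj₁⁻ (_ ∷ ps) (there h∈) with ∈-reduce-proj₁⁻ ps h∈
  ... | y , y∈ , r = y , there y∈ , r

  ∈-reduce-proj₁⁺ : ∀ {ys y} (ps : All (λ y → ∃ (R y)) ys) →
    y ∈ ys → ∃ λ h → h ∈ All.reduce proj₁ ps × R y h
  ∈-reduce-proj₁⁺ ((h , r) ∷ _) (here refl) = h , here refl , r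
  ∈-reduce-proj₁⁺ (_ ∷ ps) (there y∈) with ∈-reduce-proj₁⁺ ps y∈
  ... | h , h∈ , r = h , there h∈ , r

module _ {A : Set} {_⇒_ : A → A → Set} (P : A → Set) (μ : A → ℕ)
  (step : ∀ {x y} → P x → x ⇒ y → P y × μ y < μ x) where

  accessible-by-measure : ∀ {x} → P x → Acc (flip _⇒_) x
  accessible-by-measure {x} = go (<-wellFounded (μ x))
    where
    go : ∀ {x} → Acc _<_ (μ x) → P x → Acc (flip _⇒_) x
    go (acc rs) px = acc λ x⇒y → let py , μy<μx = step px x⇒y in go (rs μy<μx) py

module SpragueGrundy {A : Set} (_⇒_ : A → A → Set) where

  mutual
    IsSG-functional : ∀ {x g g'} → Acc (flip _⇒_) x → IsSG _⇒_ x g → IsSG _⇒_ x g' → g ≡ g'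
    IsSG-functional ac sg sg' = ≤-antisym (≮⇒≥ (IsSG-≮ ac sg' sg)) (≮⇒≥ (IsSG-≮ ac sg sg'))

    IsSG-≮ : ∀ {x g g'} → Acc (flip _⇒_) x → IsSG _⇒_ x g → IsSG _⇒_ x g' → ¬ g < g'
    IsSG-≮ (acc rs) sg (isSG reach _) g<g' with reach g<g'
    ... | y , x⇒y , y:g = option-value-≢ (rs x⇒y) sg x⇒y y:g refl

    option-value-≢ : ∀ {x y g h} → Acc (flip _⇒_) y →
      IsSG _⇒_ x g → x ⇒ y → IsSG _⇒_ y h → h ≢ g
    option-value-≢ ac (isSG _ avoid) x⇒y y:h with avoid x⇒y
    ... | h' , y:h' , h'≢g = λ h≡g → h'≢g (trans (IsSG-functional ac y:h' y:h) h≡g)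

  module _ (options : A → List A) (options-spec : ∀ {x y} → x ⇒ y ⇔ y ∈ options x) where
    open Equivalence

    IsSG-mex : ∀ {x} → All (λ y → ∃ (IsSG _⇒_ y)) (options x) → ∃ (IsSG _⇒_ x)
    IsSG-mex {x} ps with mex (All.reduce proj₁ ps)
    ... | g , below , g∉ = g , isSG reach avoid
      where
      reach : ∀ {h} → h < g → ∃ λ y → x ⇒ y × IsSG _⇒_ y h
      reach h<g with ∈-reduce-proj₁⁻ ps (below h<g)
      ... | y , y∈ , y:h = y , from options-spec y∈ , y:h
      avoid : ∀ {y} → x ⇒ y → ∃ λ h → IsSG _⇒_ y h × h ≢ g
      avoid x⇒y with ∈-reduce-proj₁⁺ ps (to options-spec x⇒y)
      ... | h , h∈ , y:h = h , y:h , λ { refl → g∉ h∈ }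

    IsSG-total : ∀ {x} → Acc (flip _⇒_) x → ∃ (IsSG _⇒_ x)
    IsSG-total (acc rs) = IsSG-mex (All.tabulate λ y∈ → IsSG-total (rs (from options-spec y∈)))

module Transfer {A B : Set} {_⇒A_ : A → A → Set} {_⇒B_ : B → B → Set}
  (wf-B : WellFounded (flip _⇒B_)) (total-B : ∀ z → ∃ (IsSG _⇒B_ z))
  (P : A → Set) (f : A → B)
  (preserves : ∀ {x y} → P x → x ⇒A y → P y)
  (project : ∀ {x y} → P x → x ⇒A y → f x ⇒B f y ⊎ f y ⇒B f x)
  (lift : ∀ {x z} → P x → f x ⇒B z → ∃ λ y → x ⇒A y × f y ≡ z) where

  open SpragueGrundy _⇒B_ using (option-value-≢)

  IsSG-transfer : ∀ {x g} → Acc (flip _⇒A_) x → P x → IsSG _⇒B_ (f x) g → IsSG _⇒A_ x g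
  IsSG-transfer {x} {g} (acc rs) px fx:g@(isSG reach _) = isSG reachA avoidA
    where
    reachA : ∀ {h} → h < g → ∃ λ y → x ⇒A y × IsSG _⇒A_ y h
    reachA h<g with reach h<g
    ... | z , fx⇒z , z:h with lift px fx⇒z
    ...   | y , x⇒y , refl = y , x⇒y , IsSG-transfer (rs x⇒y) (preserves px x⇒y) z:h
    avoidA : ∀ {y} → x ⇒A y → ∃ λ h → IsSG _⇒A_ y h × h ≢ g
    avoidA {y} x⇒y with total-B (f y)
    ... | h , fy:h = h , IsSG-transfer (rs x⇒y) (preserves px x⇒y) fy:h , values-differ (project px x⇒y)
      where
      values-differ : f x ⇒B f y ⊎ f y ⇒B f x → h ≢ g
      values-differ (inj₁ fx⇒fy) = option-value-≢ (wf-B (f y)) fx:g fx⇒fy fy:h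
      values-differ (inj₂ fy⇒fx) = option-value-≢ (wf-B (f x)) fy:h fy⇒fx fx:g ∘ sym

nimMove-decreases-sum : ∀ {xs ys} → NimMove xs ys → sum ys < sum xs
nimMove-decreases-sum {x ∷ xs} (here y<x) = +-monoˡ-< (sum xs) y<x
nimMove-decreases-sum {x ∷ xs} (there mv) = +-monoʳ-< x (nimMove-decreases-sum mv)

nim-wellFounded : WellFounded (flip NimMove)
nim-wellFounded = Subrelation.wellFounded nimMove-decreases-sum (On.wellFounded sum <-wellFounded)

nimOptions : List ℕ → List (List ℕ)
nimOptions []       = []
nimOptions (x ∷ xs) = map (_∷ xs) (downFrom x) ++ map (x ∷_) (nimOptions xs)

nimMove⇔∈nimOptions : ∀ {xs ys} → NimMove xs ys ⇔ ys ∈ nimOptions xs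
nimMove⇔∈nimOptions = mk⇔ complete sound
  where
  complete : ∀ {xs ys} → NimMove xs ys → ys ∈ nimOptions xs
  complete {x ∷ xs} (here y<x) = ∈-++⁺ˡ (∈-map⁺ (_∷ xs) (∈-downFrom⁺ y<x))
  complete {x ∷ xs} (there mv) = ∈-++⁺ʳ (map (_∷ xs) (downFrom x)) (∈-map⁺ (x ∷_) (complete mv))
  sound : ∀ {xs ys} → ys ∈ nimOptions xs → NimMove xs ys
  sound {x ∷ xs} ys∈ with ∈-++⁻ (map (_∷ xs) (downFrom x)) ys∈
  ... | inj₁ ys∈ˡ with ∈-map⁻ (_∷ xs) ys∈ˡ
  ...   | y , y∈ , refl = here (∈-downFrom⁻ y∈)
  sound {x ∷ xs} ys∈ | inj₂ ys∈ʳ with ∈-map⁻ (x ∷_) ys∈ʳ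
  ...   | zs , zs∈ , refl = there (sound zs∈)

nim-total : ∀ xs → ∃ (IsSG NimMove xs)
nim-total xs = SpragueGrundy.IsSG-total NimMove nimOptions nimMove⇔∈nimOptions (nim-wellFounded xs)

data ShortenRow : List ℕ → List ℕ → Set where
  here  : ∀ {x y xs} → head0 xs ≤ y → y < x → ShortenRow (x ∷ xs) (y ∷ xs)
  there : ∀ {x xs ys} → ShortenRow xs ys → ShortenRow (x ∷ xs) (x ∷ ys)

partition-<-head : ∀ {k xs} → IsPartition xs → head0 xs < k → All (_< k) xs
partition-<-head {xs = []}    _         _      = []
partition-<-head {xs = _ ∷ _} [-]       x<k    = x<k ∷ []
partition-<-head {xs = _ ∷ _} (y≤x ∷ p) x<k    = x<k ∷ partition-<-head p (≤-<-trans y≤x x<k)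

any-≤-false : ∀ {k xs} → All (_< k) xs → any (λ y → ⌊ k ≤? y ⌋) xs ≡ false
any-≤-false []                 = refl
any-≤-false {k} {y ∷ _} (y<k ∷ ys<k) with k ≤? y
... | yes k≤y = ⊥-elim (<⇒≱ y<k k≤y)
... | no _    = any-≤-false ys<k

shorten-here : ∀ {k x xs} → All (_< k) xs → k ≤ x → shorten k (x ∷ xs) ≡ (k ∸ 1) ∷ xs
shorten-here {k} {x} xs<k k≤x rewrite any-≤-false xs<k with k ≤? x
... | yes _   = refl
... | no k≰x  = ⊥-elim (k≰x k≤x)

shorten-there : ∀ {k x z zs} → k ≤ z → shorten k (x ∷ z ∷ zs) ≡ x ∷ shorten k (z ∷ zs)
shorten-there {k} {z = z} k≤z with k ≤? z
... | yes _   = refl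
... | no k≰z  = ⊥-elim (k≰z k≤z)

shortenRow⇒ritMove : ∀ {l m} → IsPartition l → ShortenRow l m → RITMove l m
shortenRow⇒ritMove {x ∷ xs} p (here {y = y} h y<x) =
  suc y , s≤s z≤n , y<x , sym (shorten-here (partition-<-head (tail p) (s≤s h)) y<x)
shortenRow⇒ritMove {x ∷ z ∷ zs} (z≤x ∷ p) (there s) with shortenRow⇒ritMove p s
... | k , 1≤k , k≤z , refl = k , 1≤k , ≤-trans k≤z z≤x , sym (shorten-there k≤z)

shorten⇒shortenRow : ∀ {k l} → IsPartition l → 1 ≤ k → k ≤ head0 l → ShortenRow l (shorten k l)
shorten⇒shortenRow {suc k} {x ∷ []} _ _ k<x rewrite shorten-here {suc k} {x} [] k<x = here z≤n k<x
shorten⇒shortenRow {suc k} {x ∷ z ∷ zs} (z≤x ∷ p) _ k<x with ≤-<-connex (suc k) z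
... | inj₁ k<z rewrite shorten-there {suc k} {x} {z} {zs} k<z = there (shorten⇒shortenRow p (s≤s z≤n) k<z)
... | inj₂ z≤k rewrite shorten-here (partition-<-head p z≤k) k<x = here (≤-pred z≤k) k<x

ritMove⇒shortenRow : ∀ {l m} → IsPartition l → RITMove l m → ShortenRow l m
ritMove⇒shortenRow p (k , 1≤k , k≤hd , refl) = shorten⇒shortenRow p 1≤k k≤hd

shortenRow-preserves-partition : ∀ {l m} → IsPartition l → ShortenRow l m → IsPartition m
shortenRow-preserves-partition [-]       (here _ _)          = [-]
shortenRow-preserves-partition (_ ∷ p)   (here h _)          = h ∷ p
shortenRow-preserves-partition (z≤x ∷ p) (there (here h w<z)) =
  ≤-trans (<⇒≤ w<z) z≤x ∷ shortenRow-preserves-partition p (here h w<z)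
shortenRow-preserves-partition (z≤x ∷ p) (there (there s))   =
  z≤x ∷ shortenRow-preserves-partition p (there s)

shortenRow-decreases-sum : ∀ {l m} → ShortenRow l m → sum m < sum l
shortenRow-decreases-sum {x ∷ xs} (here _ y<x) = +-monoˡ-< (sum xs) y<x
shortenRow-decreases-sum {x ∷ xs} (there s)    = +-monoʳ-< x (shortenRow-decreases-sum s)

rit-accessible : ∀ {l} → IsPartition l → Acc (flip RITMove) l
rit-accessible = accessible-by-measure IsPartition sum step
  where
  step : ∀ {l m} → IsPartition l → RITMove l m → IsPartition m × sum m < sum l
  step p mv = shortenRow-preserves-partition p s , shortenRow-decreases-sum s
    where s = ritMove⇒shortenRow p mv

shortenRow-rem : ∀ {l m} → IsPartition l → ShortenRow l m →
  NimMove (rem l) (rem m) ⊎ NimMove (rem m) (rem l)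
shortenRow-rem [-]       (here _ y<x)          = inj₁ (here y<x)
shortenRow-rem (_ ∷ _)   (here z≤y y<x)        = inj₁ (here (∸-monoˡ-< y<x z≤y))
shortenRow-rem (z≤x ∷ _) (there (here _ w<z))  = inj₂ (here (∸-monoʳ-< w<z z≤x))
shortenRow-rem (_ ∷ p)   (there (there s))     = Sum.map there there (shortenRow-rem (tail p) s)

shortenRow-lift : ∀ {l z} → IsPartition l → NimMove (rem l) z → ∃ λ m → ShortenRow l m × rem m ≡ z
shortenRow-lift {x ∷ []}     _         (here {y = y} y<x) = y ∷ [] , here z≤n y<x , refl
shortenRow-lift {x ∷ w ∷ ws} (w≤x ∷ _) (here {y = y} y<x∸w) =
  w + y ∷ w ∷ ws , here (m≤m+n w y) w+y<x , cong (_∷ rem ws) (m+n∸m≡n w y)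
  where
  w+y<x : w + y < x
  w+y<x = subst (w + y <_) (m+[n∸m]≡n w≤x) (+-monoʳ-< w y<x∸w)
shortenRow-lift {x ∷ w ∷ _}  (_ ∷ p)   (there mv) with shortenRow-lift (tail p) mv
... | m , s , refl = x ∷ w ∷ m , there (there s) , refl

ritMove-lift : ∀ {l z} → IsPartition l → NimMove (rem l) z → ∃ λ m → RITMove l m × rem m ≡ z
ritMove-lift p mv with shortenRow-lift p mv
... | m , s , eq = m , shortenRow⇒ritMove p s , eq

module RemTransfer = Transfer nim-wellFounded nim-total IsPartition rem
  (λ p → shortenRow-preserves-partition p ∘ ritMove⇒shortenRow p)
  (λ p → shortenRow-rem p ∘ ritMove⇒shortenRow p)
  ritMove-lift

theorem3p3 : (l : List ℕ) → IsPartition l →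
    (Σ ℕ λ g → IsSG RITMove l g × IsSG NimMove (rem l) g) ×
    ((g : ℕ) → IsSG RITMove l g ⇔ IsSG NimMove (rem l) g)
theorem3p3 l p with nim-total (rem l)
... | g , nim:g = (g , rem-transfer nim:g , nim:g) , λ g' → mk⇔ (nim-value g') rem-transfer
  where
  rem-transfer : ∀ {g} → IsSG NimMove (rem l) g → IsSG RITMove l g
  rem-transfer = RemTransfer.IsSG-transfer (rit-accessible p) p

  nim-value : ∀ g' → IsSG RITMove l g' → IsSG NimMove (rem l) g'
  nim-value g' rit:g' = subst (IsSG NimMove (rem l)) g≡g' nim:g
    where
    g≡g' : g ≡ g'
    g≡g' = SpragueGrundy.IsSG-functional RITMove (rit-accessible p) (rem-transfer nim:g) rit:g'
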